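{- Algorithm 2 (described in the context) is correct: when run on a single-homomorphism system $S$ in standard form, if it stops with failure then $S$ has no unifier modulo one-sided distributivity, and if it exits with success then $S$ is unifiable modulo one-sided distributivity.
   Context: One-sided distributivity: the equational theory over binary $+,\times$ generated by $X \times (Y+Z) = X\times Y + X \times Z$; unification is elementary. Typed setting: types $\tau_1,\tau_2$ with $\times:\tau_1*\tau_2\to\tau_2$, $+:\tau_2*\tau_2\to\tau_2$. A single-homomorphism system in standard form is a finite set of equations with exactly one variable $T$ of type $\tau_1$, each equation of the form $X=^?Y$ ($Y\ne X$), $X =^? Y+Z$ or $X =^? T\times Y$ (written $X=^?h(Y)$), all of $X,Y,Z$ of type $\tau_2$. Data structures. The graph $\mathcal{LD}$: nodes are $\tau_2$-variables; a lateral edge $X \xrightarrow{h^n} Y$ ($n\ge 1$, $n$ stored in binary) represents the equation $X = h^n(Y)$ (initially one edge labeled $h^1$ per equation $X=^?h(Y)$); downward edges $X\to X_1$, $X \to X_2$ for each equation $X=^?X_1+X_2$. Let $\sim_h$ be the equivalence closure of the lateral-edge relation; $\mathcal{LP}$ has the $\sim_h$-classes as vertices and an edge $[X]\to[Y]$ iff some $U\in[X]$ has a downward edge to some $V\in[Y]$. The order $[X]\gtrdot_h[Y]$ holds iff there is such an edge. Inference rules. (0) If $U =^? V$ is present and $U$ occurs elsewhere, replace $U$ by $V$ everywhere else. (i) From $U=^?U_1+U_2$, $U=^?U_3+U_4$ derive $U=^?U_1+U_2$, $U_3=^?U_1$, $U_4=^?U_2$. (ii) From $X\xrightarrow{\eta}Y$,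 $Z\xrightarrow{\pi}Y$ with $|\eta|=|\pi|$ derive $X=^?Z$, $Z\xrightarrow{\pi}Y$. (iii) From $X\xrightarrow{\eta}Y$, $X\xrightarrow{\pi}Z$ with $|\eta|=|\pi|$ derive $X\xrightarrow{\pi}Z$, $Y=^?Z$. (iv) From $X\xrightarrow{h^j}Y$, $X\xrightarrow{h^i}Z$ with $j<i$ derive $Y\xrightarrow{h^{i-j}}Z$, $X\xrightarrow{h^i}Z$. (v) From $X\xrightarrow{h^i}Y$, $Y\xrightarrow{h^j}Z$ derive $X\xrightarrow{h^{i+j}}Z$, $Y\xrightarrow{h^j}Z$. (vi) FAIL if $\mathcal{LP}$ or $\mathcal{LD}$ has a cycle. (vii) From $U\xrightarrow{\eta}W$, $U=^?U_1+U_2$ derive $U\xrightarrow{\eta}W$, $W=^?W_1+W_2$, $U_1\xrightarrow{\eta}W_1$, $U_2\xrightarrow{\eta}W_2$, where $W_1,W_2$ are fresh variables only if $W$ has no downward edges, and otherwise are the existing summands of $W$. (In each rule the premises are replaced by the conclusions.) Algorithm 2. Step 1: build $\mathcal{LD}$ and $\mathcal{LP}$. Step 2: exhaustively apply (0)–(iv). Step 3: if a cycle is found in either graph, stop with failure. Step 4: select a not yet processed class that is maximal for $\gtrdot_h$ among unprocessed classes; in it apply rule (v) exhaustively, starting at the sink of each path and working back to its start node, then apply (vii) if applicable. Step 5: if no rule applies and no cycle exists, exit with success; otherwise return to Step 2. -}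

module Defs where

open import Data.Nat using (ℕ; zero; suc; _+_; _∸_; _<_; _≡ᵇ_)
open import Data.Bool using (if_then_else_)
open import Data.List using (List; []; _∷_; _++_; map)
open import Data.List.Membership.Propositional using (_∈_)
open import Data.List.Relation.Unary.Any using (Any)
open import Data.List.Relation.Binary.Permutation.Propositional using (_↭_)
open import Data.Product using (Σ; ∃; ∃₂; _×_; _,_)
open import Data.Sum using (_⊎_)
open import Relation.Nullary using (¬_)
open import Relation.Binary.PropositionalEquality using (_≡_; _≢_)
open import Relation.Binary.Construct.Closure.ReflexiveTransitive using (Star)
open import Relation.Binary.Construct.Closure.Transitive using (TransClosure)
open import Relation.Binary.Construct.Closure.Equivalence using (EqClosure)

-- Typed terms over the signature  × : τ₁ * τ₂ → τ₂ ,  + : τ₂ * τ₂ → τ₂.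
-- There are no function symbols with result type τ₁, so τ₁-terms are
-- exactly τ₁-variables.

Var₁ : Set
Var₁ = ℕ

Var₂ : Set
Var₂ = ℕ

infixl 6 _⊕_
infixr 7 _⊗_

data Tm : Set where
  var : Var₂ → Tm
  _⊕_ : Tm → Tm → Tm
  _⊗_ : Var₁ → Tm → Tm

infix 4 _≈_
data _≈_ : Tm → Tm → Set where
  ≈-refl  : ∀ {s} → s ≈ s
  ≈-sym   : ∀ {s t} → s ≈ t → t ≈ s
  ≈-trans : ∀ {s t u} → s ≈ t → t ≈ u → s ≈ u
  ⊕-cong  : ∀ {s s′ t t′} → s ≈ s′ → t ≈ t′ → s ⊕ t ≈ s′ ⊕ t′
  ⊗-cong  : ∀ {x s s′} → s ≈ s′ → x ⊗ s ≈ x ⊗ s′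
  distrib : ∀ x s t → x ⊗ (s ⊕ t) ≈ (x ⊗ s) ⊕ (x ⊗ t)

-- Single-homomorphism systems in standard form (single τ₁-variable T,
-- which is implicit: h(Y) stands for T × Y).

data SEq : Set where
  eqVar : (X Y : Var₂) → X ≢ Y → SEq
  eqSum : (X Y Z : Var₂) → SEq
  eqHom : (X Y : Var₂) → SEq

System : Set
System = List SEq

-- Unifiers: the τ₁-variable T is mapped to a τ₁-term (a τ₁-variable) t,
-- the τ₂-variables are mapped to τ₂-terms by σ.
SEqHolds : Var₁ → (Var₂ → Tm) → SEq → Set
SEqHolds t σ (eqVar X Y _) = σ X ≈ σ Y
SEqHolds t σ (eqSum X Y Z) = σ X ≈ σ Y ⊕ σ Z
SEqHolds t σ (eqHom X Y)    = σ X ≈ t ⊗ σ Y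

IsUnifier : System → Var₁ → (Var₂ → Tm) → Set
IsUnifier S t σ = ∀ {e} → e ∈ S → SEqHolds t σ e

Unifiable : System → Set
Unifiable S = Σ Var₁ λ t → Σ (Var₂ → Tm) λ σ → IsUnifier S t σ

-- Algorithm states: the graph LD together with the pending equations
-- X =? Y, represented as a multiset (list up to permutation) of:
--   X ≔ Y          : X =? Y
--   X ≔ Y ⊞ Z      : X =? Y + Z         (downward edges X → Y, X → Z)
--   X ─[ n ]→ Y    : lateral edge X --h^n--> Y , i.e. X = h^n(Y)

data Eqn : Set where
  _≔_      : (X Y : Var₂) → Eqn
  _≔_⊞_    : (X Y Z : Var₂) → Eqn
  _─[_]→_  : (X : Var₂) (n : ℕ) (Y : Var₂) → Eqn

State : Set
State = List Eqn

initEqn : SEq → Eqn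
initEqn (eqVar X Y _) = X ≔ Y
initEqn (eqSum X Y Z) = X ≔ Y ⊞ Z
initEqn (eqHom X Y)    = X ─[ 1 ]→ Y

initState : System → State
initState S = map initEqn S

varsEqn : Eqn → List Var₂
varsEqn (X ≔ Y)      = X ∷ Y ∷ []
varsEqn (X ≔ Y ⊞ Z)  = X ∷ Y ∷ Z ∷ []
varsEqn (X ─[ n ]→ Y) = X ∷ Y ∷ []

OccursIn : Var₂ → State → Set
OccursIn U Γ = Any (λ e → U ∈ varsEqn e) Γ

ren : Var₂ → Var₂ → Var₂ → Var₂
ren U V x = if x ≡ᵇ U then V else x

renEqn : Var₂ → Var₂ → Eqn → Eqn
renEqn U V (X ≔ Y)       = ren U V X ≔ ren U V Y
renEqn U V (X ≔ Y ⊞ Z)   = ren U V X ≔ ren U V Y ⊞ ren U V Z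
renEqn U V (X ─[ n ]→ Y) = ren U V X ─[ n ]→ ren U V Y

data LocalRule : State → State → Set where
  rule-i   : ∀ U U₁ U₂ U₃ U₄ →
             LocalRule (U ≔ U₁ ⊞ U₂ ∷ U ≔ U₃ ⊞ U₄ ∷ [])
                       (U ≔ U₁ ⊞ U₂ ∷ U₃ ≔ U₁ ∷ U₄ ≔ U₂ ∷ [])
  rule-ii  : ∀ X Y Z n →
             LocalRule (X ─[ n ]→ Y ∷ Z ─[ n ]→ Y ∷ [])
                       (X ≔ Z ∷ Z ─[ n ]→ Y ∷ [])
  rule-iii : ∀ X Y Z n →
             LocalRule (X ─[ n ]→ Y ∷ X ─[ n ]→ Z ∷ [])
                       (X ─[ n ]→ Z ∷ Y ≔ Z ∷ [])
  rule-iv  : ∀ X Y Z i j → j < i →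
             LocalRule (X ─[ j ]→ Y ∷ X ─[ i ]→ Z ∷ [])
                       (Y ─[ i ∸ j ]→ Z ∷ X ─[ i ]→ Z ∷ [])
  rule-v   : ∀ X Y Z i j →
             LocalRule (X ─[ i ]→ Y ∷ Y ─[ j ]→ Z ∷ [])
                       (X ─[ i + j ]→ Z ∷ Y ─[ j ]→ Z ∷ [])

HasDownEdge : Var₂ → State → Set
HasDownEdge W Γ = ∃₂ λ W₁ W₂ → (W ≔ W₁ ⊞ W₂) ∈ Γ

data Step : State → State → Set where
  -- (0): U =? V present (U ≠ V, so the replacement is not vacuous) and U
  --      occurs elsewhere: replace U by V in all other equations.
  rule-0   : ∀ {Γ R} U V → U ≢ V → Γ ↭ (U ≔ V ∷ R) → OccursIn U R →
             Step Γ (U ≔ V ∷ map (renEqn U V) R)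
  local    : ∀ {Γ R P C} → LocalRule P C → Γ ↭ (P ++ R) →
             Step Γ (C ++ R)
  rule-vii-fresh :
             ∀ {Γ R} U U₁ U₂ W W₁ W₂ n →
             Γ ↭ (U ─[ n ]→ W ∷ U ≔ U₁ ⊞ U₂ ∷ R) →
             ¬ HasDownEdge W Γ →
             ¬ OccursIn W₁ Γ → ¬ OccursIn W₂ Γ → W₁ ≢ W₂ →
             Step Γ (U ─[ n ]→ W ∷ W ≔ W₁ ⊞ W₂ ∷
                     U₁ ─[ n ]→ W₁ ∷ U₂ ─[ n ]→ W₂ ∷ R)
  rule-vii-old :
             ∀ {Γ R} U U₁ U₂ W W₁ W₂ n →
             Γ ↭ (U ─[ n ]→ W ∷ U ≔ U₁ ⊞ U₂ ∷ R) →
             (W ≔ W₁ ⊞ W₂) ∈ R →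
             Step Γ (U ─[ n ]→ W ∷ U₁ ─[ n ]→ W₁ ∷ U₂ ─[ n ]→ W₂ ∷ R)

Lateral : State → Var₂ → Var₂ → Set
Lateral Γ X Y = ∃ λ n → (X ─[ n ]→ Y) ∈ Γ

Down : State → Var₂ → Var₂ → Set
Down Γ X Y = ∃ λ Z → ((X ≔ Y ⊞ Z) ∈ Γ) ⊎ ((X ≔ Z ⊞ Y) ∈ Γ)

LDEdge : State → Var₂ → Var₂ → Set
LDEdge Γ X Y = Lateral Γ X Y ⊎ Down Γ X Y

_∼h[_]_ : Var₂ → State → Var₂ → Set
X ∼h[ Γ ] Y = EqClosure (Lateral Γ) X Y

-- edges of LP, expressed on representatives: [X] → [Y]
LPEdge : State → Var₂ → Var₂ → Set
LPEdge Γ X Y = ∃₂ λ U V → X ∼h[ Γ ] U × Down Γ U V × V ∼h[ Γ ] Y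

HasCycle : State → Set
HasCycle Γ = (∃ λ X → TransClosure (LDEdge Γ) X X)
           ⊎ (∃ λ X → TransClosure (LPEdge Γ) X X)

_⟶*_ : State → State → Set
_⟶*_ = Star Step

StopsWithFailure : System → Set
StopsWithFailure S = ∃ λ Γ → initState S ⟶* Γ × HasCycle Γ

ExitsWithSuccess : System → Set
ExitsWithSuccess S =
  ∃ λ Γ → initState S ⟶* Γ × (∀ Γ′ → ¬ Step Γ Γ′) × ¬ HasCycle Γ

-- Modulo one-sided distributivity every term has a normal form, a tree of sums over
-- product-prefixed variables. Hence + and h^n = T × ⋯ × T × _ are injective, and
-- h^n(s) is a sum only if s is. With these facts every rule turns a state into an
-- equivalent one: solutions of the premises give solutions of the conclusions and
-- conversely, the fresh summands of rule (vii) being obtained by splitting the value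
-- of W. A solved state has no cycles: along an LD edge the normal form of the
-- solution strictly shrinks, and along an LP edge its number of summands, which is
-- constant on ∼h-classes, strictly drops. So reaching a cycle refutes every unifier.
-- Conversely, when no rule applies each variable has at most one sum or one lateral
-- edge leaving it and variable equations are isolated; if LD is also acyclic,
-- unfolding these edges |vars| + 1 times solves the final state, hence the system.

module Submission where

open import Defs
open import Data.Bool using (true; false; T)
open import Data.Empty using (⊥; ⊥-elim)
open import Data.List using (List; []; _∷_; _++_; foldr; length; filter; concatMap)
open import Data.List.Extrema.Nat using (max; xs≤max)
open import Data.List.Membership.Propositional using (_∈_)
open import Data.List.Membership.Propositional.Properties using (∈-∃++; ∈-filter⁺)
import Data.List.Membership.DecPropositional as DecMembership
open import Data.List.Properties using (filter-notAll)
open import Data.List.Relation.Unary.All as All using (All; []; _∷_)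
open import Data.List.Relation.Unary.All.Properties using (++⁺; ++⁻; map⁺; map⁻)
open import Data.List.Relation.Unary.Any as Any using (here; there)
open import Data.List.Relation.Unary.Any.Properties using (concatMap⁺)
open import Data.List.Relation.Binary.Permutation.Propositional
  using (_↭_; ↭-sym; ↭-trans; ↭-prep; ↭-refl; swap)
open import Data.List.Relation.Binary.Permutation.Propositional.Properties
  using (All-resp-↭; Any-resp-↭; ∈-resp-↭; shift)
open import Data.Maybe using (Maybe; just; nothing; fromMaybe; _<∣>_)
open import Data.Nat using (ℕ; zero; suc; _+_; _∸_; _<_; _≤_; _≟_; _≡ᵇ_; s≤s; z≤n)
open import Data.Nat.Properties
  using ( ≤-refl; ≤-trans; ≤-pred; <⇒≤; ≤-<-trans; <-trans; <-irrefl; <-cmp; n≤1+n; 1+n≢n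
        ; +-mono-<; m≤m+n; m≤n+m; m<m+n; m<n+m; m+[n∸m]≡n; m<n⇒0<n∸m; ≡ᵇ⇒≡; ≟-diag
        ; module ≤-Reasoning)
open import Data.Product using (∃; ∃₂; _×_; _,_; proj₁; proj₂)
open import Data.Sum using (_⊎_; inj₁; inj₂)
open import Data.Unit using (⊤; tt)
open import Function using (id; _∘_)
open import Level using (0ℓ)
open import Relation.Binary using (Rel; Setoid; DecidableEquality; tri<; tri≈; tri>)
open import Relation.Binary.PropositionalEquality as ≡
  using (_≡_; _≢_; refl; sym; trans; cong; cong₂; subst)
open import Relation.Binary.Construct.Closure.Equivalence using (gfold)
open import Relation.Binary.Construct.Closure.ReflexiveTransitive using (ε; _◅_)
open import Relation.Binary.Construct.Closure.Transitive using (TransClosure; [_]; _∷_; _∷ʳ_)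
import Relation.Binary.Reasoning.Setoid as SetoidReasoning
open import Relation.Nullary using (¬_; yes; no; ¬?; contradiction)

≡⇒≈ : ∀ {s t} → s ≡ t → s ≈ t
≡⇒≈ refl = ≈-refl

≈-setoid : Setoid 0ℓ 0ℓ
≈-setoid = record
  { Carrier = Tm ; _≈_ = _≈_
  ; isEquivalence = record { refl = ≈-refl ; sym = ≈-sym ; trans = ≈-trans } }

infixr 7 _⊗[_]_
_⊗[_]_ : Var₁ → ℕ → Tm → Tm
t ⊗[ zero ] s = s
t ⊗[ suc n ] s = t ⊗ t ⊗[ n ] s

⊗[]-+ : ∀ t i j s → t ⊗[ i + j ] s ≡ t ⊗[ i ] t ⊗[ j ] s
⊗[]-+ t zero j s = refl
⊗[]-+ t (suc i) j s = cong (t ⊗_) (⊗[]-+ t i j s)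

⊗[]-cong : ∀ t n {a b} → a ≈ b → t ⊗[ n ] a ≈ t ⊗[ n ] b
⊗[]-cong t zero a≈b = a≈b
⊗[]-cong t (suc n) a≈b = ⊗-cong (⊗[]-cong t n a≈b)

⊗[]-distrib : ∀ t n a b → t ⊗[ n ] (a ⊕ b) ≈ t ⊗[ n ] a ⊕ t ⊗[ n ] b
⊗[]-distrib t zero a b = ≈-refl
⊗[]-distrib t (suc n) a b = ≈-trans (⊗-cong (⊗[]-distrib t n a b)) (distrib t _ _)

-- leaf [x₁, …, xₖ] v stands for x₁ × (⋯ (xₖ × v)): distributivity pushes every
-- product below every sum.
data NF : Set where
  leaf : List Var₁ → Var₂ → NF
  node : NF → NF → NF

push : Var₁ → NF → NF
push x (leaf xs v) = leaf (x ∷ xs) v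
push x (node m n) = node (push x m) (push x n)

nf : Tm → NF
nf (var v) = leaf [] v
nf (a ⊕ b) = node (nf a) (nf b)
nf (x ⊗ a) = push x (nf a)

⟦_⟧ : NF → Tm
⟦ leaf xs v ⟧ = foldr _⊗_ (var v) xs
⟦ node m n ⟧ = ⟦ m ⟧ ⊕ ⟦ n ⟧

⟦push⟧ : ∀ x n → x ⊗ ⟦ n ⟧ ≈ ⟦ push x n ⟧
⟦push⟧ x (leaf xs v) = ≈-refl
⟦push⟧ x (node m n) = ≈-trans (distrib x ⟦ m ⟧ ⟦ n ⟧) (⊕-cong (⟦push⟧ x m) (⟦push⟧ x n))

≈⟦nf⟧ : ∀ s → s ≈ ⟦ nf s ⟧
≈⟦nf⟧ (var v) = ≈-refl
≈⟦nf⟧ (a ⊕ b) = ⊕-cong (≈⟦nf⟧ a) (≈⟦nf⟧ b)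
≈⟦nf⟧ (x ⊗ a) = ≈-trans (⊗-cong (≈⟦nf⟧ a)) (⟦push⟧ x (nf a))

≈⇒nf≡ : ∀ {s t} → s ≈ t → nf s ≡ nf t
≈⇒nf≡ ≈-refl = refl
≈⇒nf≡ (≈-sym p) = sym (≈⇒nf≡ p)
≈⇒nf≡ (≈-trans p q) = trans (≈⇒nf≡ p) (≈⇒nf≡ q)
≈⇒nf≡ (⊕-cong p q) = cong₂ node (≈⇒nf≡ p) (≈⇒nf≡ q)
≈⇒nf≡ (⊗-cong {x} p) = cong (push x) (≈⇒nf≡ p)
≈⇒nf≡ (distrib x s t) = refl

nf≡⇒≈ : ∀ {s t} → nf s ≡ nf t → s ≈ t
nf≡⇒≈ {s} {t} eq = ≈-trans (≈⟦nf⟧ s) (≈-trans (≡⇒≈ (cong ⟦_⟧ eq)) (≈-sym (≈⟦nf⟧ t)))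

node-injective : ∀ {m n m′ n′} → node m n ≡ node m′ n′ → m ≡ m′ × n ≡ n′
node-injective refl = refl , refl

push-injective : ∀ x {m n} → push x m ≡ push x n → m ≡ n
push-injective x {leaf _ _} {leaf _ _} refl = refl
push-injective x {node _ _} {node _ _} eq with node-injective eq
... | eq₁ , eq₂ = cong₂ node (push-injective x eq₁) (push-injective x eq₂)

⊕-injective : ∀ {a b c d} → a ⊕ b ≈ c ⊕ d → a ≈ c × b ≈ d
⊕-injective p with node-injective (≈⇒nf≡ p)
... | eq₁ , eq₂ = nf≡⇒≈ eq₁ , nf≡⇒≈ eq₂

⊗[]-injective : ∀ t n {a b} → t ⊗[ n ] a ≈ t ⊗[ n ] b → a ≈ b
⊗[]-injective t zero p = p
⊗[]-injective t (suc n) p = ⊗[]-injective t n (nf≡⇒≈ (push-injective t (≈⇒nf≡ p)))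

⊗[]-⊕-injective : ∀ t n {a b u v} → t ⊗[ n ] (a ⊕ b) ≈ u ⊕ v →
                  u ≈ t ⊗[ n ] a × v ≈ t ⊗[ n ] b
⊗[]-⊕-injective t n {a} {b} p = ⊕-injective (≈-trans (≈-sym p) (⊗[]-distrib t n a b))

⊗[]-⊕-lift : ∀ t n {u w w₁ w₂ u₁ u₂} → u ≈ t ⊗[ n ] w → w ≈ w₁ ⊕ w₂ →
             u₁ ≈ t ⊗[ n ] w₁ → u₂ ≈ t ⊗[ n ] w₂ → u ≈ u₁ ⊕ u₂
⊗[]-⊕-lift t n {w₁ = w₁} {w₂} u≈ w≈ u₁≈ u₂≈ =
  ≈-trans u≈ (≈-trans (⊗[]-cong t n w≈)
    (≈-trans (⊗[]-distrib t n w₁ w₂) (⊕-cong (≈-sym u₁≈) (≈-sym u₂≈))))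

push-node : ∀ x m {p q} → push x m ≡ node p q → ∃₂ λ p′ q′ → m ≡ node p′ q′
push-node x (node m n) _ = m , n , refl

nf-⊗[]-node : ∀ t n s {p q} → nf (t ⊗[ n ] s) ≡ node p q → ∃₂ λ p′ q′ → nf s ≡ node p′ q′
nf-⊗[]-node t zero s eq = _ , _ , eq
nf-⊗[]-node t (suc n) s eq with push-node t (nf (t ⊗[ n ] s)) eq
... | _ , _ , eq′ = nf-⊗[]-node t n s eq′

⊗[]-split : ∀ t n {s u v} → t ⊗[ n ] s ≈ u ⊕ v →
            ∃₂ λ a b → s ≈ a ⊕ b × u ≈ t ⊗[ n ] a × v ≈ t ⊗[ n ] b
⊗[]-split t n {s} p with nf-⊗[]-node t n s (≈⇒nf≡ p)
... | m , m′ , eq = ⟦ m ⟧ , ⟦ m′ ⟧ , s≈ , ⊗[]-⊕-injective t n (≈-trans (⊗[]-cong t n (≈-sym s≈)) p)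
  where
  s≈ : s ≈ ⟦ m ⟧ ⊕ ⟦ m′ ⟧
  s≈ = ≈-trans (≈⟦nf⟧ s) (≡⇒≈ (cong ⟦_⟧ eq))

size : NF → ℕ
size (leaf xs _) = suc (length xs)
size (node m n) = suc (size m + size n)

leaves : NF → ℕ
leaves (leaf _ _) = 1
leaves (node m n) = leaves m + leaves n

size-push : ∀ x n → size n < size (push x n)
size-push x (leaf xs v) = ≤-refl
size-push x (node m n) = s≤s (+-mono-< (size-push x m) (size-push x n))

size-⊗[]-≤ : ∀ t n s → size (nf s) ≤ size (nf (t ⊗[ n ] s))
size-⊗[]-≤ t zero s = ≤-refl
size-⊗[]-≤ t (suc n) s = ≤-trans (size-⊗[]-≤ t n s) (<⇒≤ (size-push t (nf (t ⊗[ n ] s))))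

size-⊗[] : ∀ t n s → 0 < n → size (nf s) < size (nf (t ⊗[ n ] s))
size-⊗[] t (suc n) s _ = ≤-<-trans (size-⊗[]-≤ t n s) (size-push t (nf (t ⊗[ n ] s)))

leaves-push : ∀ x n → leaves (push x n) ≡ leaves n
leaves-push x (leaf xs v) = refl
leaves-push x (node m n) = cong₂ _+_ (leaves-push x m) (leaves-push x n)

leaves-⊗[] : ∀ t n s → leaves (nf (t ⊗[ n ] s)) ≡ leaves (nf s)
leaves-⊗[] t zero s = refl
leaves-⊗[] t (suc n) s = trans (leaves-push t (nf (t ⊗[ n ] s))) (leaves-⊗[] t n s)

leaves-positive : ∀ n → 0 < leaves n
leaves-positive (leaf _ _) = s≤s z≤n
leaves-positive (node m n) = ≤-trans (leaves-positive m) (m≤m+n _ _)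

EqnHolds : Var₁ → (Var₂ → Tm) → Eqn → Set
EqnHolds t σ (X ≔ Y)       = σ X ≈ σ Y
EqnHolds t σ (X ≔ Y ⊞ Z)   = σ X ≈ σ Y ⊕ σ Z
EqnHolds t σ (X ─[ n ]→ Y) = σ X ≈ t ⊗[ n ] σ Y

Solves : Var₁ → (Var₂ → Tm) → State → Set
Solves t σ = All (EqnHolds t σ)

-- Invariant of all runs (no rule creates an edge h⁰); it makes lateral edges strictly
-- shrink solutions.
PositiveLabel : Eqn → Set
PositiveLabel (_ ─[ n ]→ _) = 0 < n
PositiveLabel _             = ⊤

EqnHolds-resp : ∀ {t σ σ′} e → (∀ {x} → x ∈ varsEqn e → σ x ≈ σ′ x) →
                EqnHolds t σ e → EqnHolds t σ′ e
EqnHolds-resp (X ≔ Y) f h =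
  ≈-trans (≈-sym (f (here refl))) (≈-trans h (f (there (here refl))))
EqnHolds-resp (X ≔ Y ⊞ Z) f h =
  ≈-trans (≈-sym (f (here refl)))
    (≈-trans h (⊕-cong (f (there (here refl))) (f (there (there (here refl))))))
EqnHolds-resp {t} (X ─[ n ]→ Y) f h =
  ≈-trans (≈-sym (f (here refl))) (≈-trans h (⊗[]-cong t n (f (there (here refl)))))

Solves-resp : ∀ {t σ σ′} Γ → (∀ {x} → OccursIn x Γ → σ x ≈ σ′ x) →
              Solves t σ Γ → Solves t σ′ Γ
Solves-resp [] f [] = []
Solves-resp (e ∷ Γ) f (h ∷ hs) =
  EqnHolds-resp e (f ∘ here) h ∷ Solves-resp Γ (f ∘ there) hs

unifier⇒solution : ∀ {t σ} S → IsUnifier S t σ → Solves t σ (initState S)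
unifier⇒solution [] u = []
unifier⇒solution (eqVar _ _ _ ∷ S) u = u (here refl) ∷ unifier⇒solution S (u ∘ there)
unifier⇒solution (eqSum _ _ _ ∷ S) u = u (here refl) ∷ unifier⇒solution S (u ∘ there)
unifier⇒solution (eqHom _ _   ∷ S) u = u (here refl) ∷ unifier⇒solution S (u ∘ there)

solution⇒unifier : ∀ {t σ} S → Solves t σ (initState S) → IsUnifier S t σ
solution⇒unifier (eqVar _ _ _ ∷ S) (h ∷ _) (here refl) = h
solution⇒unifier (eqSum _ _ _ ∷ S) (h ∷ _) (here refl) = h
solution⇒unifier (eqHom _ _   ∷ S) (h ∷ _) (here refl) = h
solution⇒unifier (_ ∷ S) (_ ∷ hs) (there e∈S) = solution⇒unifier S hs e∈S

initState-positive : ∀ S → All PositiveLabel (initState S)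
initState-positive [] = []
initState-positive (eqVar _ _ _ ∷ S) = tt ∷ initState-positive S
initState-positive (eqSum _ _ _ ∷ S) = tt ∷ initState-positive S
initState-positive (eqHom _ _   ∷ S) = s≤s z≤n ∷ initState-positive S

ren-≈ : ∀ (σ : Var₂ → Tm) {U V} → σ U ≈ σ V → ∀ x → σ (ren U V x) ≈ σ x
ren-≈ σ {U} U≈V x with x ≡ᵇ U in eq
... | true rewrite ≡ᵇ⇒≡ x U (subst T (sym eq) tt) = ≈-sym U≈V
... | false = ≈-refl

holds-renEqn : ∀ {t σ} U V e → EqnHolds t σ (renEqn U V e) ≡ EqnHolds t (σ ∘ ren U V) e
holds-renEqn U V (X ≔ Y)       = refl
holds-renEqn U V (X ≔ Y ⊞ Z)   = refl
holds-renEqn U V (X ─[ n ]→ Y) = refl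

renEqn-preserves : ∀ {t σ U V} e → σ U ≈ σ V → EqnHolds t σ e → EqnHolds t σ (renEqn U V e)
renEqn-preserves {σ = σ} {U} {V} e U≈V h =
  subst id (sym (holds-renEqn U V e)) (EqnHolds-resp e (λ {x} _ → ≈-sym (ren-≈ σ U≈V x)) h)

renEqn-reflects : ∀ {t σ U V} e → σ U ≈ σ V → EqnHolds t σ (renEqn U V e) → EqnHolds t σ e
renEqn-reflects {σ = σ} {U} {V} e U≈V h =
  EqnHolds-resp e (λ {x} _ → ren-≈ σ U≈V x) (subst id (holds-renEqn U V e) h)

renEqn-positive : ∀ U V e → PositiveLabel e → PositiveLabel (renEqn U V e)
renEqn-positive U V (X ≔ Y)       p = p
renEqn-positive U V (X ≔ Y ⊞ Z)   p = p
renEqn-positive U V (X ─[ n ]→ Y) p = p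

⊗[]-∸ : ∀ t {i j} s → j < i → t ⊗[ i ] s ≡ t ⊗[ j ] t ⊗[ i ∸ j ] s
⊗[]-∸ t {i} {j} s j<i =
  trans (cong (λ k → t ⊗[ k ] s) (sym (m+[n∸m]≡n (<⇒≤ j<i)))) (⊗[]-+ t j (i ∸ j) s)

LocalRule-preserves : ∀ {t σ P C} → LocalRule P C → Solves t σ P → Solves t σ C
LocalRule-preserves (rule-i _ _ _ _ _) (h₁ ∷ h₂ ∷ []) with ⊕-injective (≈-trans (≈-sym h₂) h₁)
... | U₃≈U₁ , U₄≈U₂ = h₁ ∷ U₃≈U₁ ∷ U₄≈U₂ ∷ []
LocalRule-preserves (rule-ii _ _ _ _) (h₁ ∷ h₂ ∷ []) = ≈-trans h₁ (≈-sym h₂) ∷ h₂ ∷ []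
LocalRule-preserves {t} (rule-iii _ _ _ n) (h₁ ∷ h₂ ∷ []) =
  h₂ ∷ ⊗[]-injective t n (≈-trans (≈-sym h₁) h₂) ∷ []
LocalRule-preserves {t} {σ} (rule-iv _ _ Z i j j<i) (h₁ ∷ h₂ ∷ []) =
  ⊗[]-injective t j (≈-trans (≈-sym h₁) (≈-trans h₂ (≡⇒≈ (⊗[]-∸ t (σ Z) j<i)))) ∷ h₂ ∷ []
LocalRule-preserves {t} {σ} (rule-v _ _ Z i j) (h₁ ∷ h₂ ∷ []) =
  ≈-trans h₁ (≈-trans (⊗[]-cong t i h₂) (≡⇒≈ (sym (⊗[]-+ t i j (σ Z))))) ∷ h₂ ∷ []

LocalRule-reflects : ∀ {t σ P C} → LocalRule P C → Solves t σ C → Solves t σ P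
LocalRule-reflects (rule-i _ _ _ _ _) (h₁ ∷ h₂ ∷ h₃ ∷ []) =
  h₁ ∷ ≈-trans h₁ (⊕-cong (≈-sym h₂) (≈-sym h₃)) ∷ []
LocalRule-reflects (rule-ii _ _ _ _) (h₁ ∷ h₂ ∷ []) = ≈-trans h₁ h₂ ∷ h₂ ∷ []
LocalRule-reflects {t} (rule-iii _ _ _ n) (h₁ ∷ h₂ ∷ []) =
  ≈-trans h₁ (⊗[]-cong t n (≈-sym h₂)) ∷ h₁ ∷ []
LocalRule-reflects {t} {σ} (rule-iv _ _ Z i j j<i) (h₁ ∷ h₂ ∷ []) =
  ≈-trans h₂ (≈-trans (≡⇒≈ (⊗[]-∸ t (σ Z) j<i)) (⊗[]-cong t j (≈-sym h₁))) ∷ h₂ ∷ []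
LocalRule-reflects {t} {σ} (rule-v _ _ Z i j) (h₁ ∷ h₂ ∷ []) =
  ≈-trans h₁ (≈-trans (≡⇒≈ (⊗[]-+ t i j (σ Z))) (⊗[]-cong t i (≈-sym h₂))) ∷ h₂ ∷ []

LocalRule-positive : ∀ {P C} → LocalRule P C → All PositiveLabel P → All PositiveLabel C
LocalRule-positive (rule-i _ _ _ _ _) _ = tt ∷ tt ∷ tt ∷ []
LocalRule-positive (rule-ii _ _ _ _) (_ ∷ p ∷ []) = tt ∷ p ∷ []
LocalRule-positive (rule-iii _ _ _ _) (_ ∷ p ∷ []) = p ∷ tt ∷ []
LocalRule-positive (rule-iv _ _ _ i j j<i) (_ ∷ p ∷ []) = m<n⇒0<n∸m j<i ∷ p ∷ []
LocalRule-positive (rule-v _ _ _ i j) (p ∷ q ∷ []) = ≤-trans p (m≤m+n i j) ∷ q ∷ []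

_[_↦_] : (Var₂ → Tm) → Var₂ → Tm → Var₂ → Tm
(σ [ W ↦ a ]) x with x ≟ W
... | yes _ = a
... | no _  = σ x

[↦]-same : ∀ σ W a → (σ [ W ↦ a ]) W ≡ a
[↦]-same σ W a with W ≟ W
... | yes _ = refl
... | no W≢W = contradiction refl W≢W

[↦]-other : ∀ σ {W x} a → x ≢ W → (σ [ W ↦ a ]) x ≡ σ x
[↦]-other σ {W} {x} a x≢W with x ≟ W
... | yes x≡W = contradiction x≡W x≢W
... | no _  = refl

occurs : ∀ {x e Γ} → e ∈ Γ → x ∈ varsEqn e → OccursIn x Γ
occurs (here refl) x∈e = here x∈e
occurs (there e∈Γ) x∈e = there (occurs e∈Γ x∈e)

absent≢ : ∀ {x W Γ} → OccursIn x Γ → ¬ OccursIn W Γ → x ≢ W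
absent≢ x∈Γ W∉Γ refl = W∉Γ x∈Γ

private
  module ≈-Reasoning = SetoidReasoning ≈-setoid

rule-vii-fresh-preserves :
  ∀ {t σ Γ R} U U₁ U₂ W W₁ W₂ n → Γ ↭ (U ─[ n ]→ W ∷ U ≔ U₁ ⊞ U₂ ∷ R) →
  ¬ OccursIn W₁ Γ → ¬ OccursIn W₂ Γ → W₁ ≢ W₂ → Solves t σ Γ →
  ∃ λ σ′ → Solves t σ′ (U ─[ n ]→ W ∷ W ≔ W₁ ⊞ W₂ ∷ U₁ ─[ n ]→ W₁ ∷ U₂ ─[ n ]→ W₂ ∷ R)
rule-vii-fresh-preserves {t} {σ} {Γ} U U₁ U₂ W W₁ W₂ n Γ↭ W₁∉Γ W₂∉Γ W₁≢W₂ sol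
  with h₁ ∷ h₂ ∷ hR ← All-resp-↭ Γ↭ sol
  with a , b , W≈a⊕b , U₁≈ , U₂≈ ← ⊗[]-split t n (≈-trans (≈-sym h₁) h₂)
  = σ′ , kept (∈-resp-↭ (↭-sym Γ↭) (here refl)) h₁
       ∷ W-holds
       ∷ Uᵢ-holds U₁ W₁ a (occ (there (here (there (here refl))))) σ′W₁ U₁≈
       ∷ Uᵢ-holds U₂ W₂ b (occ (there (here (there (there (here refl)))))) σ′W₂ U₂≈
       ∷ Solves-resp _ (λ x∈R → ≡⇒≈ (sym (unchanged (occ (there (there x∈R)))))) hR
  where
  open ≈-Reasoning
  σ′ : Var₂ → Tm
  σ′ = σ [ W₂ ↦ b ] [ W₁ ↦ a ]
  occ : ∀ {x} → OccursIn x (U ─[ n ]→ W ∷ U ≔ U₁ ⊞ U₂ ∷ _) → OccursIn x Γ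
  occ = Any-resp-↭ (↭-sym Γ↭)
  unchanged : ∀ {x} → OccursIn x Γ → σ′ x ≡ σ x
  unchanged x∈Γ = trans ([↦]-other _ a (absent≢ x∈Γ W₁∉Γ)) ([↦]-other σ b (absent≢ x∈Γ W₂∉Γ))
  kept : ∀ {e} → e ∈ Γ → EqnHolds t σ e → EqnHolds t σ′ e
  kept {e} e∈Γ = EqnHolds-resp e (λ x∈e → ≡⇒≈ (sym (unchanged (occurs e∈Γ x∈e))))
  σ′W₁ : σ′ W₁ ≡ a
  σ′W₁ = [↦]-same _ W₁ a
  σ′W₂ : σ′ W₂ ≡ b
  σ′W₂ = trans ([↦]-other _ a (W₁≢W₂ ∘ sym)) ([↦]-same σ W₂ b)
  W-holds : σ′ W ≈ σ′ W₁ ⊕ σ′ W₂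
  W-holds = begin
    σ′ W              ≡⟨ unchanged (occ (here (there (here refl)))) ⟩
    σ W               ≈⟨ W≈a⊕b ⟩
    a ⊕ b             ≡⟨ cong₂ _⊕_ σ′W₁ σ′W₂ ⟨
    σ′ W₁ ⊕ σ′ W₂     ∎
  Uᵢ-holds : ∀ Uᵢ Wᵢ c → OccursIn Uᵢ Γ → σ′ Wᵢ ≡ c → σ Uᵢ ≈ t ⊗[ n ] c → σ′ Uᵢ ≈ t ⊗[ n ] σ′ Wᵢ
  Uᵢ-holds Uᵢ Wᵢ c Uᵢ∈Γ σ′Wᵢ Uᵢ≈ = begin
    σ′ Uᵢ             ≡⟨ unchanged Uᵢ∈Γ ⟩
    σ Uᵢ              ≈⟨ Uᵢ≈ ⟩
    t ⊗[ n ] c        ≡⟨ cong (t ⊗[ n ]_) σ′Wᵢ ⟨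
    t ⊗[ n ] σ′ Wᵢ    ∎

Step-preserves : ∀ {t σ Γ Γ′} → Step Γ Γ′ → Solves t σ Γ → ∃ λ σ′ → Solves t σ′ Γ′
Step-preserves {σ = σ} (rule-0 _ _ _ Γ↭ _) sol with h ∷ hR ← All-resp-↭ Γ↭ sol =
  σ , h ∷ map⁺ (All.map (λ {e} → renEqn-preserves e h) hR)
Step-preserves {σ = σ} (local {P = P} rule Γ↭) sol with hP , hR ← ++⁻ P (All-resp-↭ Γ↭ sol) =
  σ , ++⁺ (LocalRule-preserves rule hP) hR
Step-preserves (rule-vii-fresh U U₁ U₂ W W₁ W₂ n Γ↭ _ W₁∉Γ W₂∉Γ W₁≢W₂) =
  rule-vii-fresh-preserves U U₁ U₂ W W₁ W₂ n Γ↭ W₁∉Γ W₂∉Γ W₁≢W₂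
Step-preserves {t} {σ} (rule-vii-old _ _ _ _ _ _ n Γ↭ W∈R) sol
  with h₁ ∷ h₂ ∷ hR ← All-resp-↭ Γ↭ sol
  with U₁≈ , U₂≈ ← ⊗[]-⊕-injective t n
         (≈-trans (⊗[]-cong t n (≈-sym (All.lookup hR W∈R))) (≈-trans (≈-sym h₁) h₂)) =
  σ , h₁ ∷ U₁≈ ∷ U₂≈ ∷ hR

Step-reflects : ∀ {t σ Γ Γ′} → Step Γ Γ′ → Solves t σ Γ′ → Solves t σ Γ
Step-reflects (rule-0 _ _ _ Γ↭ _) (h ∷ hR) =
  All-resp-↭ (↭-sym Γ↭) (h ∷ All.map (λ {e} → renEqn-reflects e h) (map⁻ hR))
Step-reflects (local {C = C} rule Γ↭) sol with hC , hR ← ++⁻ C sol =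
  All-resp-↭ (↭-sym Γ↭) (++⁺ (LocalRule-reflects rule hC) hR)
Step-reflects {t} (rule-vii-fresh _ _ _ _ _ _ n Γ↭ _ _ _ _) (h₁ ∷ hW ∷ h₃ ∷ h₄ ∷ hR) =
  All-resp-↭ (↭-sym Γ↭) (h₁ ∷ ⊗[]-⊕-lift t n h₁ hW h₃ h₄ ∷ hR)
Step-reflects {t} (rule-vii-old _ _ _ _ _ _ n Γ↭ W∈R) (h₁ ∷ h₃ ∷ h₄ ∷ hR) =
  All-resp-↭ (↭-sym Γ↭) (h₁ ∷ ⊗[]-⊕-lift t n h₁ (All.lookup hR W∈R) h₃ h₄ ∷ hR)

Step-positive : ∀ {Γ Γ′} → Step Γ Γ′ → All PositiveLabel Γ → All PositiveLabel Γ′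
Step-positive (rule-0 U V _ Γ↭ _) pos with p ∷ pR ← All-resp-↭ Γ↭ pos =
  p ∷ map⁺ (All.map (λ {e} → renEqn-positive U V e) pR)
Step-positive (local {P = P} rule Γ↭) pos with pP , pR ← ++⁻ P (All-resp-↭ Γ↭ pos) =
  ++⁺ (LocalRule-positive rule pP) pR
Step-positive (rule-vii-fresh _ _ _ _ _ _ _ Γ↭ _ _ _ _) pos
  with p ∷ _ ∷ pR ← All-resp-↭ Γ↭ pos = p ∷ tt ∷ p ∷ p ∷ pR
Step-positive (rule-vii-old _ _ _ _ _ _ _ Γ↭ _) pos
  with p ∷ _ ∷ pR ← All-resp-↭ Γ↭ pos = p ∷ p ∷ p ∷ pR

Run-preserves : ∀ {t σ Γ Γ′} → Γ ⟶* Γ′ → Solves t σ Γ → All PositiveLabel Γ →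
                ∃ λ σ′ → Solves t σ′ Γ′ × All PositiveLabel Γ′
Run-preserves ε sol pos = _ , sol , pos
Run-preserves (step ◅ run) sol pos with σ′ , sol′ ← Step-preserves step sol =
  Run-preserves run sol′ (Step-positive step pos)

Run-reflects : ∀ {t σ Γ Γ′} → Γ ⟶* Γ′ → Solves t σ Γ′ → Solves t σ Γ
Run-reflects ε sol = sol
Run-reflects (step ◅ run) sol = Step-reflects step (Run-reflects run sol)

TransClosure-decreasing : ∀ {A : Set} {R : Rel A 0ℓ} (f : A → ℕ) → (∀ {x y} → R x y → f y < f x) →
                          ∀ {x y} → TransClosure R x y → f y < f x
TransClosure-decreasing f dec [ r ] = dec r
TransClosure-decreasing f dec (r ∷ rs) = <-trans (TransClosure-decreasing f dec rs) (dec r)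

decreasing⇒acyclic : ∀ {A : Set} {R : Rel A 0ℓ} (f : A → ℕ) → (∀ {x y} → R x y → f y < f x) →
                     ∀ {x} → ¬ TransClosure R x x
decreasing⇒acyclic f dec c = <-irrefl refl (TransClosure-decreasing f dec c)

module _ {t σ Γ} (sol : Solves t σ Γ) (pos : All PositiveLabel Γ) where

  private
    sz lv : Var₂ → ℕ
    sz X = size (nf (σ X))
    lv X = leaves (nf (σ X))

    sz≈ : ∀ {X a} → σ X ≈ a → sz X ≡ size (nf a)
    sz≈ = cong size ∘ ≈⇒nf≡

    lv≈ : ∀ {X a} → σ X ≈ a → lv X ≡ leaves (nf a)
    lv≈ = cong leaves ∘ ≈⇒nf≡

  LDEdge-size : ∀ {X Y} → LDEdge Γ X Y → sz Y < sz X
  LDEdge-size {X} {Y} (inj₁ (n , e∈Γ)) = begin-strict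
    sz Y                        <⟨ size-⊗[] t n (σ Y) (All.lookup pos e∈Γ) ⟩
    size (nf (t ⊗[ n ] σ Y))    ≡⟨ sz≈ (All.lookup sol e∈Γ) ⟨
    sz X                        ∎
    where open ≤-Reasoning
  LDEdge-size {X} {Y} (inj₂ (Z , inj₁ e∈Γ)) =
    ≡.subst (sz Y <_) (sym (sz≈ (All.lookup sol e∈Γ))) (s≤s (m≤m+n (sz Y) (sz Z)))
  LDEdge-size {X} {Y} (inj₂ (Z , inj₂ e∈Γ)) =
    ≡.subst (sz Y <_) (sym (sz≈ (All.lookup sol e∈Γ))) (s≤s (m≤n+m (sz Y) (sz Z)))

  ∼h-leaves : ∀ {X Y} → X ∼h[ Γ ] Y → lv X ≡ lv Y
  ∼h-leaves = gfold ≡.isEquivalence lv along-edge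
    where
    along-edge : ∀ {X Y} → Lateral Γ X Y → lv X ≡ lv Y
    along-edge {Y = Y} (n , e∈Γ) = trans (lv≈ (All.lookup sol e∈Γ)) (leaves-⊗[] t n (σ Y))

  Down-leaves : ∀ {X Y} → Down Γ X Y → lv Y < lv X
  Down-leaves {X} {Y} (Z , inj₁ e∈Γ) =
    ≡.subst (lv Y <_) (sym (lv≈ (All.lookup sol e∈Γ))) (m<m+n (lv Y) (leaves-positive (nf (σ Z))))
  Down-leaves {X} {Y} (Z , inj₂ e∈Γ) =
    ≡.subst (lv Y <_) (sym (lv≈ (All.lookup sol e∈Γ))) (m<n+m (lv Y) (leaves-positive (nf (σ Z))))

  LPEdge-leaves : ∀ {X Y} → LPEdge Γ X Y → lv Y < lv X
  LPEdge-leaves (U , V , X∼U , U↓V , V∼Y) =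
    ≡.subst₂ _<_ (∼h-leaves V∼Y) (sym (∼h-leaves X∼U)) (Down-leaves U↓V)

  solvable⇒acyclic : ¬ HasCycle Γ
  solvable⇒acyclic (inj₁ (_ , c)) = decreasing⇒acyclic sz LDEdge-size c
  solvable⇒acyclic (inj₂ (_ , c)) = decreasing⇒acyclic lv LPEdge-leaves c

infixr 5 _∷_

data Path {A : Set} (E : Rel A 0ℓ) : ℕ → A → Set where
  []  : ∀ {x} → Path E 0 x
  _∷_ : ∀ {k x y} → E x y → Path E k y → Path E (suc k) x

vertices : ∀ {A E k} {x : A} → Path E k x → List A
vertices {x = x} []      = x ∷ []
vertices {x = x} (_ ∷ p) = x ∷ vertices p

module _ {A : Set} (_≟_ : DecidableEquality A) {E : Rel A 0ℓ} where

  open DecMembership _≟_ using (_∈?_)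

  private
    close : ∀ {k x y} → TransClosure E x y → (p : Path E k y) → x ∈ vertices p → TransClosure E x x
    close x⁺y []      (here refl) = x⁺y
    close x⁺y (_ ∷ p) (here refl) = x⁺y
    close x⁺y (e ∷ p) (there x∈p) = close (x⁺y ∷ʳ e) p x∈p

  -- Pigeonhole: either the first vertex recurs, or the rest of the path avoids it.
  long-path⇒cycle : ∀ vs {k x} (p : Path E k x) → length vs ≤ k →
                    All (_∈ vs) (vertices p) → ∃ λ z → TransClosure E z z
  long-path⇒cycle []      []      _  (() ∷ [])
  long-path⇒cycle (_ ∷ _) []      ()
  long-path⇒cycle vs {suc k} (_∷_ {x = x} e p) |vs|≤ (x∈vs ∷ p⊆vs) with x ∈? vertices p
  ... | yes x∈p = x , close [ e ] p x∈p
  ... | no  x∉p = long-path⇒cycle (filter (λ y → ¬? (y ≟ x)) vs) p shorter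
                    (All.tabulate (λ {y} y∈p → ∈-filter⁺ _ (All.lookup p⊆vs y∈p) (y≢x y∈p)))
    where
    shorter : length (filter (λ y → ¬? (y ≟ x)) vs) ≤ k
    shorter = ≤-pred (≤-trans (filter-notAll _ vs (Any.map (λ { refl x≢x → x≢x refl }) x∈vs)) |vs|≤)
    y≢x : ∀ {y} → y ∈ vertices p → y ≢ x
    y≢x y∈p refl = x∉p y∈p

  acyclic⇒paths-bounded : ∀ vs → (∀ {x y} → E x y → x ∈ vs × y ∈ vs) →
                          (∀ {z} → ¬ TransClosure E z z) → ∀ {x} → ¬ Path E (suc (length vs)) x
  acyclic⇒paths-bounded vs closed acyclic p@(e ∷ _) =
    acyclic (proj₂ (long-path⇒cycle vs p (n≤1+n _) (in-vs (proj₁ (closed e)) p)))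
    where
    in-vs : ∀ {k x} → x ∈ vs → (q : Path E k x) → All (_∈ vs) (vertices q)
    in-vs x∈vs []      = x∈vs ∷ []
    in-vs x∈vs (e ∷ q) = x∈vs ∷ in-vs (proj₂ (closed e)) q

∈⇒↭ : ∀ {A : Set} {x : A} {xs} → x ∈ xs → ∃ λ ys → xs ↭ x ∷ ys
∈⇒↭ x∈xs with ys , zs , refl ← ∈-∃++ x∈xs = ys ++ zs , shift _ ys zs

∈-∈⇒↭ : ∀ {A : Set} {x y : A} {xs} → x ∈ xs → y ∈ xs → x ≡ y ⊎ ∃ λ ys → xs ↭ x ∷ y ∷ ys
∈-∈⇒↭ x∈xs y∈xs with ys , xs↭ ← ∈⇒↭ x∈xs with ∈-resp-↭ xs↭ y∈xs
... | here y≡x = inj₁ (sym y≡x)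
... | there y∈ys with zs , ys↭ ← ∈⇒↭ y∈ys = inj₂ (zs , ↭-trans xs↭ (↭-prep _ ys↭))

firstJust : ∀ {A B : Set} → (A → Maybe B) → List A → Maybe B
firstJust f []       = nothing
firstJust f (x ∷ xs) = f x <∣> firstJust f xs

module _ {A B : Set} {f : A → Maybe B} where

  firstJust-sound : ∀ {xs b} → firstJust f xs ≡ just b → ∃ λ x → x ∈ xs × f x ≡ just b
  firstJust-sound {x ∷ xs} eq with f x in fx
  ... | just _  = x , here refl , trans fx eq
  ... | nothing with y , y∈xs , fy ← firstJust-sound eq = y , there y∈xs , fy

  firstJust-unique : ∀ {xs x b} → (∀ {y c} → y ∈ xs → f y ≡ just c → c ≡ b) →
                     x ∈ xs → f x ≡ just b → firstJust f xs ≡ just b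
  firstJust-unique {y ∷ xs} uniq x∈xs fx with f y in fy
  ... | just _  = cong just (uniq (here refl) fy)
  ... | nothing with x∈xs
  ...   | here refl   = contradiction (trans (sym fy) fx) λ ()
  ...   | there x∈xs′ = firstJust-unique (uniq ∘ there) x∈xs′ fx

  firstJust-nothing : ∀ {xs} → (∀ {x c} → x ∈ xs → f x ≢ just c) → firstJust f xs ≡ nothing
  firstJust-nothing {[]}     none = refl
  firstJust-nothing {y ∷ xs} none with f y in fy
  ... | just _  = contradiction fy (none (here refl))
  ... | nothing = firstJust-nothing (none ∘ there)

summandsAt : Var₂ → Eqn → Maybe (Var₂ × Var₂)
summandsAt X (A ≔ B ⊞ C) with A ≟ X
... | yes _ = just (B , C)
... | no  _ = nothing
summandsAt X (_ ≔ _)       = nothing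
summandsAt X (_ ─[ _ ]→ _) = nothing

lateralAt : Var₂ → Eqn → Maybe (ℕ × Var₂)
lateralAt X (A ─[ n ]→ B) with A ≟ X
... | yes _ = just (n , B)
... | no  _ = nothing
lateralAt X (_ ≔ _)     = nothing
lateralAt X (_ ≔ _ ⊞ _) = nothing

aliasAt : Var₂ → Eqn → Maybe Var₂
aliasAt X (A ≔ B) with A ≟ X | B ≟ X
... | yes _ | no _ = just B
... | _     | _    = nothing
aliasAt X (_ ≔ _ ⊞ _)   = nothing
aliasAt X (_ ─[ _ ]→ _) = nothing

summandsAt-sound : ∀ X e {B C} → summandsAt X e ≡ just (B , C) → e ≡ (X ≔ B ⊞ C)
summandsAt-sound X (A ≔ B ⊞ C) eq with A ≟ X | eq
... | yes refl | refl = refl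

lateralAt-sound : ∀ X e {n B} → lateralAt X e ≡ just (n , B) → e ≡ (X ─[ n ]→ B)
lateralAt-sound X (A ─[ n ]→ B) eq with A ≟ X | eq
... | yes refl | refl = refl

aliasAt-sound : ∀ X e {V} → aliasAt X e ≡ just V → e ≡ (X ≔ V) × X ≢ V
aliasAt-sound X (A ≔ B) eq with A ≟ X | B ≟ X | eq
... | yes refl | no B≢A | refl = refl , B≢A ∘ sym

summandsAt-self : ∀ X B C → summandsAt X (X ≔ B ⊞ C) ≡ just (B , C)
summandsAt-self X B C rewrite ≟-diag (refl {x = X}) = refl

lateralAt-self : ∀ X n B → lateralAt X (X ─[ n ]→ B) ≡ just (n , B)
lateralAt-self X n B rewrite ≟-diag (refl {x = X}) = refl

aliasAt-self : ∀ {X V} → X ≢ V → aliasAt X (X ≔ V) ≡ just V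
aliasAt-self {X} {V} X≢V with X ≟ X | V ≟ X
... | yes _   | no _    = refl
... | _       | yes V≡X = contradiction (sym V≡X) X≢V
... | no X≢X  | no _    = contradiction refl X≢X

branch : Var₂ → State → Maybe (Var₂ × Var₂)
branch X = firstJust (summandsAt X)

lateral : Var₂ → State → Maybe (ℕ × Var₂)
lateral X = firstJust (lateralAt X)

alias : Var₂ → State → Maybe Var₂
alias X = firstJust (aliasAt X)

branch-sound : ∀ {X Γ B C} → branch X Γ ≡ just (B , C) → (X ≔ B ⊞ C) ∈ Γ
branch-sound {X} eq with e , e∈Γ , at ← firstJust-sound eq =
  subst (_∈ _) (summandsAt-sound X e at) e∈Γ

lateral-sound : ∀ {X Γ n B} → lateral X Γ ≡ just (n , B) → (X ─[ n ]→ B) ∈ Γ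
lateral-sound {X} eq with e , e∈Γ , at ← firstJust-sound eq =
  subst (_∈ _) (lateralAt-sound X e at) e∈Γ

module Irreducible (Γ : State) (irreducible : ∀ Γ′ → ¬ Step Γ Γ′) (acyclic : ¬ HasCycle Γ) where

  private
    stuck : ∀ {Γ′} → ¬ Step Γ Γ′
    stuck = irreducible _

  summands-unique : ∀ {X B C B′ C′} → (X ≔ B ⊞ C) ∈ Γ → (X ≔ B′ ⊞ C′) ∈ Γ → (B′ , C′) ≡ (B , C)
  summands-unique {X} {B} {C} {B′} {C′} e∈Γ e′∈Γ with ∈-∈⇒↭ e∈Γ e′∈Γ
  ... | inj₁ refl      = refl
  ... | inj₂ (_ , Γ↭) = ⊥-elim (stuck (local (rule-i X B C B′ C′) Γ↭))

  lateral-unique : ∀ {X n Y m Y′} → (X ─[ n ]→ Y) ∈ Γ → (X ─[ m ]→ Y′) ∈ Γ → (m , Y′) ≡ (n , Y)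
  lateral-unique {X} {n} {Y} {m} {Y′} e∈Γ e′∈Γ with ∈-∈⇒↭ e∈Γ e′∈Γ | <-cmp n m
  ... | inj₁ refl      | _             = refl
  ... | inj₂ (_ , Γ↭) | tri< n<m _ _  = ⊥-elim (stuck (local (rule-iv X Y Y′ m n n<m) Γ↭))
  ... | inj₂ (_ , Γ↭) | tri≈ _ refl _ = ⊥-elim (stuck (local (rule-iii X Y Y′ n) Γ↭))
  ... | inj₂ (_ , Γ↭) | tri> _ _ m<n  =
    ⊥-elim (stuck (local (rule-iv X Y′ Y n m m<n) (↭-trans Γ↭ (swap _ _ ↭-refl))))

  alias-isolated : ∀ {X V e} → (X ≔ V) ∈ Γ → X ≢ V → e ∈ Γ → X ∈ varsEqn e → e ≡ (X ≔ V)
  alias-isolated {X} {V} a∈Γ X≢V e∈Γ X∈e with ∈-∈⇒↭ a∈Γ e∈Γ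
  ... | inj₁ a≡e       = sym a≡e
  ... | inj₂ (_ , Γ↭) = ⊥-elim (stuck (rule-0 X V X≢V Γ↭ (here X∈e)))

  branch-complete : ∀ {X B C} → (X ≔ B ⊞ C) ∈ Γ → branch X Γ ≡ just (B , C)
  branch-complete {X} {B} {C} s∈Γ = firstJust-unique
    (λ {e} e∈Γ at → summands-unique s∈Γ (subst (_∈ Γ) (summandsAt-sound X e at) e∈Γ))
    s∈Γ (summandsAt-self X B C)

  lateral-complete : ∀ {X n Y} → (X ─[ n ]→ Y) ∈ Γ → lateral X Γ ≡ just (n , Y)
  lateral-complete {X} {n} {Y} l∈Γ = firstJust-unique
    (λ {e} e∈Γ at → lateral-unique l∈Γ (subst (_∈ Γ) (lateralAt-sound X e at) e∈Γ))
    l∈Γ (lateralAt-self X n Y)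

  vars : List Var₂
  vars = concatMap varsEqn Γ

  fresh : ∀ k → ¬ OccursIn (k + suc (max 0 vars)) Γ
  fresh k occ =
    <-irrefl refl (≤-trans (m≤n+m _ k) (All.lookup (xs≤max 0 vars) (concatMap⁺ varsEqn occ)))

  -- A lateral edge and a sum at the same node would trigger rule (vii), with fresh
  -- summands or with the existing summands of the target; the latter is excluded
  -- when the target is the node itself, since then the edge is a cycle.
  lateral-sum-exclusive : ∀ {X n Y A B} → (X ─[ n ]→ Y) ∈ Γ → (X ≔ A ⊞ B) ∈ Γ → ⊥
  lateral-sum-exclusive {X} {n} {Y} {A} {B} l∈Γ s∈Γ with ∈-∈⇒↭ l∈Γ s∈Γ
  ... | inj₁ ()
  ... | inj₂ (R , Γ↭) with branch Y Γ in eq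
  ...   | just (W₁ , W₂) = summands-elsewhere (∈-resp-↭ Γ↭ (branch-sound eq))
    where
    summands-elsewhere : (Y ≔ W₁ ⊞ W₂) ∈ (X ─[ n ]→ Y ∷ X ≔ A ⊞ B ∷ R) → ⊥
    summands-elsewhere (there (here refl))  = acyclic (inj₁ (X , [ inj₁ (n , l∈Γ) ]))
    summands-elsewhere (there (there W∈R)) = stuck (rule-vii-old X A B Y W₁ W₂ n Γ↭ W∈R)
  ...   | nothing =
    stuck (rule-vii-fresh X A B Y _ _ n Γ↭ no-summands (fresh 0) (fresh 1) (1+n≢n ∘ sym))
    where
    no-summands : ¬ HasDownEdge Y Γ
    no-summands (_ , _ , s′∈Γ) with () ← trans (sym eq) (branch-complete s′∈Γ)

  branch-lateral : ∀ {X n Y} → (X ─[ n ]→ Y) ∈ Γ → branch X Γ ≡ nothing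
  branch-lateral {X} l∈Γ = firstJust-nothing
    (λ {e} e∈Γ at → lateral-sum-exclusive l∈Γ (subst (_∈ Γ) (summandsAt-sound X e at) e∈Γ))

  in-vars : ∀ {e x} → e ∈ Γ → x ∈ varsEqn e → x ∈ vars
  in-vars e∈Γ x∈e = concatMap⁺ varsEqn (occurs e∈Γ x∈e)

  LDEdge-vars : ∀ {X Y} → LDEdge Γ X Y → X ∈ vars × Y ∈ vars
  LDEdge-vars (inj₁ (_ , e∈Γ))       = in-vars e∈Γ (here refl) , in-vars e∈Γ (there (here refl))
  LDEdge-vars (inj₂ (_ , inj₁ e∈Γ)) = in-vars e∈Γ (here refl) , in-vars e∈Γ (there (here refl))
  LDEdge-vars (inj₂ (_ , inj₂ e∈Γ)) =
    in-vars e∈Γ (here refl) , in-vars e∈Γ (there (there (here refl)))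

  no-long-path : ∀ {X} → ¬ Path (LDEdge Γ) (suc (length vars)) X
  no-long-path = acyclic⇒paths-bounded _≟_ vars LDEdge-vars (λ c → acyclic (inj₁ (_ , c)))

  target : Var₂ → Var₂
  target X = fromMaybe X (alias X Γ)

  target-fixed : ∀ {X} → (∀ {V} → (X ≔ V) ∈ Γ → X ≢ V → ⊥) → target X ≡ X
  target-fixed {X} not-alias = cong (fromMaybe X) (firstJust-nothing none)
    where
    none : ∀ {e V} → e ∈ Γ → aliasAt X e ≢ just V
    none {e} e∈Γ at with e≡ , X≢V ← aliasAt-sound X e at = not-alias (subst (_∈ Γ) e≡ e∈Γ) X≢V

  target-alias : ∀ {X V} → (X ≔ V) ∈ Γ → X ≢ V → target X ≡ V
  target-alias {X} {V} a∈Γ X≢V = cong (fromMaybe X) (firstJust-unique uniq a∈Γ (aliasAt-self X≢V))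
    where
    uniq : ∀ {e c} → e ∈ Γ → aliasAt X e ≡ just c → c ≡ V
    uniq {e} e∈Γ at with refl , X≢c ← aliasAt-sound X e at
      with refl ← alias-isolated e∈Γ X≢c a∈Γ (here refl) = refl

  target-unaliased : ∀ {e x} → e ∈ Γ → x ∈ varsEqn e → (∀ {V} → x ≢ V → e ≢ (x ≔ V)) → target x ≡ x
  target-unaliased e∈Γ x∈e not-alias =
    target-fixed (λ a∈Γ x≢V → not-alias x≢V (alias-isolated a∈Γ x≢V e∈Γ x∈e))

  -- Unfold each variable along its unique sum or lateral edge; acyclicity bounds
  -- the depth, so |vars| + 1 unfoldings reach a fixed point.
  module _ (t : Var₁) where

    unfold : (Var₂ → Tm) → Var₂ → Tm
    unfold f X with branch X Γ | lateral X Γ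
    ... | just (Y , Z) | _            = f Y ⊕ f Z
    ... | nothing      | just (n , Y) = t ⊗[ n ] f Y
    ... | nothing      | nothing      = var X

    unfold-cong : ∀ {f f′ X} → (∀ {Y} → LDEdge Γ X Y → f Y ≡ f′ Y) → unfold f X ≡ unfold f′ X
    unfold-cong {X = X} agree with branch X Γ in b | lateral X Γ in l
    ... | just (Y , Z) | _            = cong₂ _⊕_ (agree (inj₂ (Z , inj₁ (branch-sound b))))
                                                  (agree (inj₂ (Y , inj₂ (branch-sound b))))
    ... | nothing      | just (n , Y) = cong (t ⊗[ n ]_) (agree (inj₁ (n , lateral-sound l)))
    ... | nothing      | nothing      = refl

    approx : ℕ → Var₂ → Tm
    approx zero    = var
    approx (suc k) = unfold (approx k)

    approx-stable : ∀ {k l X} → k ≤ l → ¬ Path (LDEdge Γ) k X → approx k X ≡ approx l X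
    approx-stable {zero}  _         no-path = ⊥-elim (no-path [])
    approx-stable {suc k} (s≤s k≤l) no-path =
      unfold-cong (λ e → approx-stable k≤l (no-path ∘ (e ∷_)))

    depth : ℕ
    depth = suc (length vars)

    approx-successor : ∀ {X Y} → LDEdge Γ X Y → approx (length vars) Y ≡ approx depth Y
    approx-successor e = approx-stable (n≤1+n _) (no-long-path ∘ (e ∷_))

    approx-⊕ : ∀ {X Y Z} → (X ≔ Y ⊞ Z) ∈ Γ → approx depth X ≡ approx depth Y ⊕ approx depth Z
    approx-⊕ {X} {Y} {Z} s∈Γ rewrite branch-complete s∈Γ =
      cong₂ _⊕_ (approx-successor (inj₂ (Z , inj₁ s∈Γ))) (approx-successor (inj₂ (Y , inj₂ s∈Γ)))

    approx-⊗ : ∀ {X n Y} → (X ─[ n ]→ Y) ∈ Γ → approx depth X ≡ t ⊗[ n ] approx depth Y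
    approx-⊗ {X} {n} {Y} l∈Γ rewrite branch-lateral l∈Γ | lateral-complete l∈Γ =
      cong (t ⊗[ n ]_) (approx-successor (inj₁ (n , l∈Γ)))

    solution : Var₂ → Tm
    solution = approx depth ∘ target

    solution-holds : ∀ {e} → e ∈ Γ → EqnHolds t solution e
    solution-holds {X ≔ Y} a∈Γ with X ≟ Y
    ... | yes refl = ≈-refl
    ... | no X≢Y = ≡⇒≈ (cong (approx depth) (trans (target-alias a∈Γ X≢Y)
                      (sym (target-unaliased a∈Γ (there (here refl)) λ { _ refl → X≢Y refl }))))
    solution-holds {X ≔ Y ⊞ Z} s∈Γ
      rewrite target-unaliased s∈Γ (here refl) (λ _ ())
            | target-unaliased s∈Γ (there (here refl)) (λ _ ())
            | target-unaliased s∈Γ (there (there (here refl))) (λ _ ()) = ≡⇒≈ (approx-⊕ s∈Γ)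
    solution-holds {X ─[ n ]→ Y} l∈Γ
      rewrite target-unaliased l∈Γ (here refl) (λ _ ())
            | target-unaliased l∈Γ (there (here refl)) (λ _ ()) = ≡⇒≈ (approx-⊗ l∈Γ)

irreducible⇒solvable : ∀ t {Γ} → (∀ Γ′ → ¬ Step Γ Γ′) → ¬ HasCycle Γ → ∃ λ σ → Solves t σ Γ
irreducible⇒solvable t irreducible acyclic =
  solution t , All.tabulate (solution-holds t)
  where open Irreducible _ irreducible acyclic

theorem5p8 : (S : System) →
    (StopsWithFailure S → ¬ Unifiable S) × (ExitsWithSuccess S → Unifiable S)
theorem5p8 S = failure , success
  where
  failure : StopsWithFailure S → ¬ Unifiable S
  failure (Γ , run , cycle) (t , σ , unifier)
    with _ , sol , pos ← Run-preserves run (unifier⇒solution S unifier) (initState-positive S)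
    = solvable⇒acyclic sol pos cycle

  success : ExitsWithSuccess S → Unifiable S
  success (Γ , run , irreducible , acyclic)
    with σ , sol ← irreducible⇒solvable 0 irreducible acyclic
    = 0 , σ , solution⇒unifier S (Run-reflects run sol)
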